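{- Let $(A,+)$ be an abelian group and let $X,Y$ be finite multisets of elements of $A^*$ (possibly $X=Y$) such that $f^r_\gamma(X)=f^r_\gamma(Y)$ for every $r\ge 0$ and $\gamma\in A$. Then for all $\alpha,\beta\in A$: 1. $f^r_\gamma(R_{\alpha,\beta}(X))=f^r_\gamma(R_{\alpha,\beta}(Y))$ for every $r\ge 0$ and $\gamma\in A$; 2. $f^r_\gamma(R_{\alpha,\beta}(X))=f^r_\gamma(R_{\beta,\alpha}(Y))$ for every $r\ge 0$ and $\gamma\in A$.
   Context: $A^*$ denotes the set of finite nonempty sequences over $A$. For $x_1\dots x_l\in A^l$ and $y\in A$, $x_1\dots x_l+y=(x_1+y)\dots(x_l+y)$. For $1\le i\le l$, $R_{\alpha,\beta,i}(x_1\dots x_l)=x_i\,(x_1\dots x_i+x_i-x_1+\alpha)\,(x_i\dots x_l+x_i-x_1+\beta)$ (concatenation, a sequence of length $l+2$), and $R_{\alpha,\beta}(x_1\dots x_l)$ is the $l$-element multiset $\{R_{\alpha,\beta,i}(x_1\dots x_l):1\le i\le l\}$. For $r\ge 0$ and $\gamma\in A$, $f^r_\gamma(x_1\dots x_l)$ is the multiset $\{x_{a_1}+\dots+x_{a_r}-(r-1)x_1+\gamma : 1\le a_1\le a_2\le\dots\le a_r\le l\}$ (one element per tuple; for $r=0$ it is $\{x_1+\gamma\}$). Any function $f$ from sequences to finite multisets is extended to finite multisets $U$ of sequences by $f(U)=\sum_{u\in U}f(u)$, a multiset sum in which multiplicities add and each $u$ is counted with its multiplicity in $U$. -}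

module Defs where

open import Level using (Level)
open import Data.Nat as ℕ using (ℕ; zero; suc)
open import Data.Fin using (Fin; toℕ)
open import Data.List as List using (List; []; _∷_; _++_; map; concatMap; take; drop; allFin; lookup)
open import Data.List.NonEmpty as List⁺ using (List⁺; _∷_; head; toList)
open import Algebra.Bundles using (AbelianGroup)
import Data.List.Relation.Binary.Permutation.Setoid as PermSetoid

module _ {c ℓ : Level} (G : AbelianGroup c ℓ) where
  open AbelianGroup G renaming (Carrier to A)

  Seq : Set c
  Seq = List⁺ A

  -- finite multisets are represented by lists, compared up to permutation
  -- (modulo the group's equality _≈_)
  _≋ₘ_ : List A → List A → Set (c Level.⊔ ℓ)
  _≋ₘ_ = PermSetoid._↭_ setoid

  _·ℕ_ : ℕ → A → A
  zero  ·ℕ x = ε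
  suc n ·ℕ x = x ∙ (n ·ℕ x)

  sumA : List A → A
  sumA = List.foldr _∙_ ε

  shiftL : List A → A → List A
  shiftL xs y = map (λ x → x ∙ y) xs

  -- all nondecreasing r-tuples of positions 1 ≤ a₁ ≤ … ≤ a_r ≤ l, given by
  -- the list of corresponding entries (x_{a₁}, …, x_{a_r}); one entry per tuple
  multichoose : ℕ → List A → List (List A)
  multichoose zero    xs       = [] ∷ []
  multichoose (suc r) []       = []
  multichoose (suc r) (x ∷ xs) = map (x ∷_) (multichoose r (x ∷ xs)) ++ multichoose (suc r) xs

  -- f^r_γ on one sequence:  x_{a₁}+…+x_{a_r} − (r−1)x₁ + γ
  -- (−(r−1)x₁ is written as x₁ − r·x₁, which also covers r = 0)
  f : ℕ → A → Seq → List A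
  f r γ x = map (λ c → ((sumA c - (r ·ℕ head x)) ∙ head x) ∙ γ) (multichoose r (toList x))

  fM : ℕ → A → List Seq → List A
  fM r γ U = concatMap (f r γ) U

  -- R_{α,β,i}, with i given as a 0-based index into x₁…x_l
  Rᵢ : A → A → (x : Seq) → Fin (List⁺.length x) → Seq
  Rᵢ α β x i =
    xi ∷ (shiftL (take (suc (toℕ i)) xs) ((xi - x₁) ∙ α)
          ++ shiftL (drop (toℕ i) xs) ((xi - x₁) ∙ β))
    where
      xs = toList x
      x₁ = head x
      xi = lookup xs i

  R : A → A → Seq → List Seq
  R α β x = map (Rᵢ α β x) (allFin (List⁺.length x))

  RM : A → A → List Seq → List Seq
  RM α β U = concatMap (R α β) U

{-# OPTIONS --safe #-}
module Submission where

open import Defs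
open import Level using (Level)
open import Data.Nat using (ℕ; zero; suc)
open import Data.Fin using (Fin; toℕ)
open import Data.List
  using (List; []; _∷_; _++_; map; concatMap; length; take; drop; lookup; tabulate; downFrom)
open import Data.List.NonEmpty using (_∷_; toList)
open import Data.List.Properties
  using (map-++; ++-assoc; map-∘; map-tabulate; concatMap-cong; concatMap-map; map-concatMap)
open import Data.List.Effectful using (module MonadProperties)
open import Data.Product using (_×_; _,_)
open import Function using (_∘_)
open import Relation.Binary using (Setoid)
open import Relation.Binary.PropositionalEquality as ≡ using (_≡_)
open import Algebra.Bundles using (AbelianGroup; CommutativeMonoid)
open import Data.List.Relation.Binary.Pointwise as Pointwise using ([]; _∷_)
import Data.List.Relation.Binary.Equality.Setoid as Equality
import Data.List.Relation.Binary.Permutation.Setoid as Permutation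
import Data.List.Relation.Binary.Permutation.Setoid.Properties as PermutationProperties
import Algebra.Properties.CommutativeSemigroup as CommutativeSemigroupProperties
import Algebra.Properties.AbelianGroup as AbelianGroupProperties
import Algebra.Properties.Monoid as MonoidProperties

-- Write d = x − x₁ for the difference sequence of x and S_r(d) for the multiset of sums of
-- r-multisubsets of d, so that f^r_γ(x) = S_r(d) + x₁ + γ.  The difference sequence of
-- R_{α,β,i}(x) is 0, (d₁…dᵢ) + α, (dᵢ…d_l) + β, and S_r(0, e) = ⋃_{k ≤ r} S_k(e); so everything
-- reduces to the multisets ⋃ᵢ (dᵢ + S_k((d₁…dᵢ) + α, (dᵢ…d_l) + β)).  Choosing in a
-- (k+1)-multisubset of d which of its k+1 entries plays the pivot dᵢ shows that this union is
-- ⋃_{j ≤ k} (jα + (k−j)β + S_{k+1}(d)).  Hence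
--   f^r_γ(R_{α,β}(x)) = ⋃_{k ≤ r} ⋃_{j ≤ k} f^{k+1}_{γ + jα + (k−j)β}(x),
-- which is additive in x and symmetric in α and β.

module ConcatMapPermutation {a ℓ} (S : Setoid a ℓ) where
  open Setoid S using (_≈_) renaming (Carrier to A)
  open Permutation S
  open PermutationProperties S
  open CommutativeSemigroupProperties
    (CommutativeMonoid.commutativeSemigroup ++-commutativeMonoid)
    using (interchange)

  private variable
    b : Level
    B C : Set b

  concatMap-const-[] : (xs : List B) → concatMap {B = A} (λ _ → []) xs ≡.≡ []
  concatMap-const-[] []       = ≡.refl
  concatMap-const-[] (x ∷ xs) = concatMap-const-[] xs

  concatMap-cong↭ : {f g : B → List A} → (∀ x → f x ↭ g x) → ∀ xs → concatMap f xs ↭ concatMap g xs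
  concatMap-cong↭ f↭g []       = ↭-refl
  concatMap-cong↭ f↭g (x ∷ xs) = ++⁺ (f↭g x) (concatMap-cong↭ f↭g xs)

  concatMap⁺ : {f : A → List A} → (∀ {x y} → x ≈ y → f x ↭ f y) →
               ∀ {xs ys} → xs ↭ ys → concatMap f xs ↭ concatMap f ys
  concatMap⁺ f-cong xs↭ys =
    PermutationProperties.foldr-commMonoid ↭-setoid ++-isCommutativeMonoid
      (map⁺ ↭-setoid f-cong xs↭ys)

  concatMap-++-distrib : (f g : B → List A) → ∀ xs →
    concatMap (λ x → f x ++ g x) xs ↭ concatMap f xs ++ concatMap g xs
  concatMap-++-distrib f g []       = ↭-refl
  concatMap-++-distrib f g (x ∷ xs) =
    ↭-trans (++⁺ˡ (f x ++ g x) (concatMap-++-distrib f g xs)) (interchange (f x) (g x) _ _)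

  concatMap-comm : (F : B → C → List A) → ∀ xs ys →
    concatMap (λ x → concatMap (F x) ys) xs ↭ concatMap (λ y → concatMap (λ x → F x y) xs) ys
  concatMap-comm F []       ys = ↭-reflexive (≡.sym (concatMap-const-[] ys))
  concatMap-comm F (x ∷ xs) ys =
    ↭-trans (++⁺ˡ (concatMap (F x) ys) (concatMap-comm F xs ys))
            (↭-sym (concatMap-++-distrib (F x) (λ y → concatMap (λ x → F x y) xs) ys))

module Properties {c ℓ} (G : AbelianGroup c ℓ) where
  open AbelianGroup G renaming (Carrier to A)
  open Permutation setoid using
    ( _↭_; ↭-refl; ↭-sym; ↭-trans; ↭-reflexive; ↭-reflexive-≋; prep; swap
    ; module PermutationReasoning)
  open PermutationProperties setoid using (++⁺; ++⁺ˡ; ++⁺ʳ; ++-comm; shifts; map⁺)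
  open Equality setoid using (_≋_; ≋-refl; ≋-sym; ≋-trans; ≋-reflexive) renaming (++⁺ to ++⁺-≋)
  open ConcatMapPermutation setoid
  open CommutativeSemigroupProperties commutativeSemigroup using (x∙yz≈y∙xz; x∙yz≈y∙zx)
  open AbelianGroupProperties G using (ε⁻¹≈ε; ⁻¹-∙-comm; xyx⁻¹≈y)
  open MonoidProperties monoid using (insertᶜ)

  infixl 6 _⊕_
  _⊕_ : List A → A → List A
  _⊕_ = shiftL G

  infixr 9 _·_
  _·_ : ℕ → A → A
  _·_ = _·ℕ_ G

  ⋃≤ : ℕ → (ℕ → List A) → List A
  ⋃≤ r F = concatMap F (downFrom (suc r))

  syntax ⋃≤ r (λ k → e) = ⋃[ k ≤ r ] e

  ·-⁻¹ : ∀ r x → r · (x ⁻¹) ≈ (r · x) ⁻¹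
  ·-⁻¹ zero    x = sym ε⁻¹≈ε
  ·-⁻¹ (suc r) x = trans (∙-congˡ (·-⁻¹ r x)) (⁻¹-∙-comm x (r · x))

  ⊕-identityʳ : ∀ xs → xs ⊕ ε ≋ xs
  ⊕-identityʳ []       = []
  ⊕-identityʳ (x ∷ xs) = identityʳ x ∷ ⊕-identityʳ xs

  ⊕-congʳ : ∀ xs {a b} → a ≈ b → xs ⊕ a ≋ xs ⊕ b
  ⊕-congʳ []       a≈b = []
  ⊕-congʳ (x ∷ xs) a≈b = ∙-congˡ a≈b ∷ ⊕-congʳ xs a≈b

  ⊕-⊕ : ∀ xs a b → xs ⊕ a ⊕ b ≋ xs ⊕ (a ∙ b)
  ⊕-⊕ []       a b = []
  ⊕-⊕ (x ∷ xs) a b = assoc x a b ∷ ⊕-⊕ xs a b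

  ⊕-⊕-cong : ∀ xs {a b a′ b′} → a ∙ b ≈ a′ ∙ b′ → xs ⊕ a ⊕ b ≋ xs ⊕ a′ ⊕ b′
  ⊕-⊕-cong xs e = ≋-trans (⊕-⊕ xs _ _) (≋-trans (⊕-congʳ xs e) (≋-sym (⊕-⊕ xs _ _)))

  ⊕-comm : ∀ xs a b → xs ⊕ a ⊕ b ≋ xs ⊕ b ⊕ a
  ⊕-comm xs a b = ⊕-⊕-cong xs (comm a b)

  ⊕⁺ : ∀ {xs ys} a → xs ↭ ys → xs ⊕ a ↭ ys ⊕ a
  ⊕⁺ a = map⁺ setoid ∙-congʳ

  concatMap-⊕ : ∀ {b} {B : Set b} (F : B → List A) xs a →
    concatMap F xs ⊕ a ≡ concatMap (λ x → F x ⊕ a) xs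
  concatMap-⊕ F xs a = map-concatMap (_∙ a) F xs

  sums : ℕ → List A → List A
  sums zero    xs       = ε ∷ []
  sums (suc r) []       = []
  sums (suc r) (x ∷ xs) = sums r (x ∷ xs) ⊕ x ++ sums (suc r) xs

  sums-multichoose : ∀ r xs → map (sumA G) (multichoose G r xs) ↭ sums r xs
  sums-multichoose zero    xs       = ↭-refl
  sums-multichoose (suc r) []       = ↭-refl
  sums-multichoose (suc r) (x ∷ xs) = begin
    map (sumA G) (map (x ∷_) C ++ D)               ≡⟨ map-++ (sumA G) (map (x ∷_) C) D ⟩
    map (sumA G) (map (x ∷_) C) ++ map (sumA G) D  ≋⟨ ++⁺-≋ (sumA-∷ C) ≋-refl ⟩
    map (sumA G) C ⊕ x ++ map (sumA G) D           ↭⟨ ++⁺ (⊕⁺ x (sums-multichoose r (x ∷ xs)))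
                                                          (sums-multichoose (suc r) xs) ⟩
    sums r (x ∷ xs) ⊕ x ++ sums (suc r) xs         ∎
    where
    open PermutationReasoning
    C = multichoose G r (x ∷ xs)
    D = multichoose G (suc r) xs
    sumA-∷ : ∀ cs → map (sumA G) (map (x ∷_) cs) ≋ map (sumA G) cs ⊕ x
    sumA-∷ []       = []
    sumA-∷ (c ∷ cs) = comm x (sumA G c) ∷ sumA-∷ cs

  sums-cong : ∀ r {xs ys} → xs ≋ ys → sums r xs ↭ sums r ys
  sums-cong zero    _             = ↭-refl
  sums-cong (suc r) []            = ↭-refl
  sums-cong (suc r) (x≈y ∷ xs≋ys) =
    ++⁺ (↭-trans (⊕⁺ _ (sums-cong r (x≈y ∷ xs≋ys))) (↭-reflexive-≋ (⊕-congʳ _ x≈y)))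
        (sums-cong (suc r) xs≋ys)

  sums-⊕ : ∀ r xs b → sums r (xs ⊕ b) ↭ sums r xs ⊕ (r · b)
  sums-⊕ zero    xs       b = prep (sym (identityʳ ε)) ↭-refl
  sums-⊕ (suc r) []       b = ↭-refl
  sums-⊕ (suc r) (x ∷ xs) b = begin
    sums r ((x ∷ xs) ⊕ b) ⊕ (x ∙ b) ++ sums (suc r) (xs ⊕ b)
      ↭⟨ ++⁺ (⊕⁺ _ (sums-⊕ r (x ∷ xs) b)) (sums-⊕ (suc r) xs b) ⟩
    sums r (x ∷ xs) ⊕ (r · b) ⊕ (x ∙ b) ++ sums (suc r) xs ⊕ (suc r · b)
      ≋⟨ ++⁺-≋ (⊕-⊕-cong (sums r (x ∷ xs)) rb∙xb≈x∙b·rb) ≋-refl ⟩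
    sums r (x ∷ xs) ⊕ x ⊕ (suc r · b) ++ sums (suc r) xs ⊕ (suc r · b)
      ≡⟨ map-++ (_∙ (suc r · b)) (sums r (x ∷ xs) ⊕ x) (sums (suc r) xs) ⟨
    (sums r (x ∷ xs) ⊕ x ++ sums (suc r) xs) ⊕ (suc r · b) ∎
    where
    open PermutationReasoning
    rb∙xb≈x∙b·rb : r · b ∙ (x ∙ b) ≈ x ∙ (b ∙ r · b)
    rb∙xb≈x∙b·rb = trans (x∙yz≈y∙xz (r · b) x b) (∙-congˡ (comm (r · b) b))

  sums-ε∷ : ∀ r xs → sums r (ε ∷ xs) ↭ ⋃[ k ≤ r ] sums k xs
  sums-ε∷ zero    xs = ↭-refl
  sums-ε∷ (suc r) xs = begin
    sums r (ε ∷ xs) ⊕ ε ++ sums (suc r) xs  ≋⟨ ++⁺-≋ (⊕-identityʳ (sums r (ε ∷ xs))) ≋-refl ⟩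
    sums r (ε ∷ xs) ++ sums (suc r) xs      ↭⟨ ++-comm (sums r (ε ∷ xs)) (sums (suc r) xs) ⟩
    sums (suc r) xs ++ sums r (ε ∷ xs)      ↭⟨ ++⁺ˡ (sums (suc r) xs) (sums-ε∷ r xs) ⟩
    ⋃[ k ≤ suc r ] sums k xs                ∎
    where open PermutationReasoning

  f-normal-form : ∀ r γ y ys → f G r γ (y ∷ ys) ↭ sums r ((y ∷ ys) ⊕ y ⁻¹) ⊕ (y ∙ γ)
  f-normal-form r γ y ys = begin
    f G r γ (y ∷ ys)                        ≋⟨ shifted (multichoose G r (y ∷ ys)) ⟩
    map (sumA G) C ⊕ r · (y ⁻¹) ⊕ (y ∙ γ)   ↭⟨ ⊕⁺ _ (⊕⁺ _ (sums-multichoose r (y ∷ ys))) ⟩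
    sums r (y ∷ ys) ⊕ r · (y ⁻¹) ⊕ (y ∙ γ)  ↭⟨ ⊕⁺ _ (sums-⊕ r (y ∷ ys) (y ⁻¹)) ⟨
    sums r ((y ∷ ys) ⊕ y ⁻¹) ⊕ (y ∙ γ)      ∎
    where
    open PermutationReasoning
    C = multichoose G r (y ∷ ys)
    shifted : ∀ cs →
      map (λ c → ((sumA G c - r · y) ∙ y) ∙ γ) cs ≋ map (sumA G) cs ⊕ r · (y ⁻¹) ⊕ (y ∙ γ)
    shifted []       = []
    shifted (c ∷ cs) = trans (assoc _ y γ) (∙-congʳ (∙-congˡ (sym (·-⁻¹ r y)))) ∷ shifted cs

  f-cong : ∀ n {δ δ′} → δ ≈ δ′ → ∀ x → f G n δ x ↭ f G n δ′ x
  f-cong n δ≈δ′ x = ↭-reflexive-≋ (Pointwise.map⁺ _ _ (Pointwise.refl (∙-congˡ δ≈δ′)))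

  fM-cong : ∀ n {δ δ′} → δ ≈ δ′ → ∀ X → fM G n δ X ↭ fM G n δ′ X
  fM-cong n δ≈δ′ = concatMap-cong↭ (f-cong n δ≈δ′)

  -- (x₁…xᵢ , xᵢ , xᵢ…x_l): the data from which R_{α,β,i}(x) is built.
  Pivoted : Set c
  Pivoted = List A × A × List A

  pivotAt : (xs : List A) → Fin (length xs) → Pivoted
  pivotAt xs i = take (suc (toℕ i)) xs , lookup xs i , drop (toℕ i) xs

  consPrefix : A → Pivoted → Pivoted
  consPrefix u (P , p , S) = u ∷ P , p , S

  pivots : List A → List Pivoted
  pivots []       = []
  pivots (u ∷ us) = map (consPrefix u) (([] , u , u ∷ us) ∷ pivots us)

  tabulate-pivotAt : ∀ xs → tabulate (pivotAt xs) ≡ pivots xs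
  tabulate-pivotAt []       = ≡.refl
  tabulate-pivotAt (u ∷ us) = ≡.cong (_ ∷_) (≡.trans
    (≡.sym (map-tabulate (pivotAt us) (consPrefix u)))
    (≡.cong (map (consPrefix u)) (tabulate-pivotAt us)))

  infixl 6 _⊕ᵖ_
  _⊕ᵖ_ : Pivoted → A → Pivoted
  (P , p , S) ⊕ᵖ b = P ⊕ b , p ∙ b , S ⊕ b

  pivots-⊕ : ∀ xs b → pivots (xs ⊕ b) ≡ map (_⊕ᵖ b) (pivots xs)
  pivots-⊕ []       b = ≡.refl
  pivots-⊕ (u ∷ us) b = begin
    map (consPrefix (u ∙ b)) (([] , u ∙ b , (u ∷ us) ⊕ b) ∷ pivots (us ⊕ b))
      ≡⟨ ≡.cong (λ ts → map (consPrefix (u ∙ b)) (_ ∷ ts)) (pivots-⊕ us b) ⟩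
    map (consPrefix (u ∙ b)) (map (_⊕ᵖ b) ts)  ≡⟨ map-∘ ts ⟨
    map ((_⊕ᵖ b) ∘ consPrefix u) ts            ≡⟨ map-∘ ts ⟩
    map (_⊕ᵖ b) (map (consPrefix u) ts)        ∎
    where
    open ≡.≡-Reasoning
    ts = ([] , u , u ∷ us) ∷ pivots us

  module _ (α β : A) where

    Rpivot : A → Pivoted → Seq G
    Rpivot x₁ (P , p , S) = p ∷ (P ⊕ ((p - x₁) ∙ α) ++ S ⊕ ((p - x₁) ∙ β))

    R-pivots : ∀ x₁ rest → R G α β (x₁ ∷ rest) ≡ map (Rpivot x₁) (pivots (x₁ ∷ rest))
    R-pivots x₁ rest = ≡.trans (map-tabulate (λ i → i) (Rᵢ G α β (x₁ ∷ rest))) (≡.trans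
      (≡.sym (map-tabulate (pivotAt (x₁ ∷ rest)) (Rpivot x₁)))
      (≡.cong (map (Rpivot x₁)) (tabulate-pivotAt (x₁ ∷ rest))))

    Rpivot-differences : ∀ x₁ P p S →
      toList (Rpivot x₁ (P , p , S)) ⊕ p ⁻¹ ≋ ε ∷ (P ⊕ x₁ ⁻¹ ⊕ α ++ S ⊕ x₁ ⁻¹ ⊕ β)
    Rpivot-differences x₁ P p S = inverseʳ p ∷ ≋-trans
      (≋-reflexive (map-++ (_∙ p ⁻¹) (P ⊕ ((p - x₁) ∙ α)) (S ⊕ ((p - x₁) ∙ β))))
      (++⁺-≋ (recentre P α) (recentre S β))
      where
      recentre : ∀ Q a → Q ⊕ ((p - x₁) ∙ a) ⊕ p ⁻¹ ≋ Q ⊕ x₁ ⁻¹ ⊕ a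
      recentre Q a = ⊕-⊕-cong Q (trans (∙-congʳ (assoc p (x₁ ⁻¹) a)) (xyx⁻¹≈y p (x₁ ⁻¹ ∙ a)))

    pivotTerm : ℕ → Pivoted → List A
    pivotTerm k (P , p , S) = sums k (P ⊕ α ++ S ⊕ β) ⊕ p

    f-Rpivot : ∀ r γ x₁ t →
      f G r γ (Rpivot x₁ t) ↭ (⋃[ k ≤ r ] pivotTerm k (t ⊕ᵖ x₁ ⁻¹)) ⊕ (x₁ ∙ γ)
    f-Rpivot r γ x₁ (P , p , S) = begin
      f G r γ (Rpivot x₁ (P , p , S))
        ↭⟨ f-normal-form r γ p _ ⟩
      sums r (toList (Rpivot x₁ (P , p , S)) ⊕ p ⁻¹) ⊕ (p ∙ γ)
        ↭⟨ ⊕⁺ _ (sums-cong r (Rpivot-differences x₁ P p S)) ⟩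
      sums r (ε ∷ L) ⊕ (p ∙ γ)
        ↭⟨ ⊕⁺ _ (sums-ε∷ r L) ⟩
      (⋃[ k ≤ r ] sums k L) ⊕ (p ∙ γ)
        ≋⟨ ≋-trans (⊕-congʳ _ (insertᶜ (inverseˡ x₁) p γ)) (≋-sym (⊕-⊕ _ _ _)) ⟩
      (⋃[ k ≤ r ] sums k L) ⊕ (p ∙ x₁ ⁻¹) ⊕ (x₁ ∙ γ)
        ≡⟨ ≡.cong (_⊕ (x₁ ∙ γ)) (concatMap-⊕ (λ k → sums k L) (downFrom (suc r)) (p ∙ x₁ ⁻¹)) ⟩
      (⋃[ k ≤ r ] pivotTerm k ((P , p , S) ⊕ᵖ x₁ ⁻¹)) ⊕ (x₁ ∙ γ) ∎
      where
      open PermutationReasoning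
      L = P ⊕ x₁ ⁻¹ ⊕ α ++ S ⊕ x₁ ⁻¹ ⊕ β

    pivotTerm-consPrefix : ∀ k u t → pivotTerm (suc k) (consPrefix u t) ↭
      pivotTerm k (consPrefix u t) ⊕ (u ∙ α) ++ pivotTerm (suc k) t
    pivotTerm-consPrefix k u (P , p , S) = ↭-reflexive-≋ (≋-trans
      (≋-reflexive (map-++ (_∙ p) (sums k L′ ⊕ (u ∙ α)) (sums (suc k) L)))
      (++⁺-≋ (⊕-comm (sums k L′) (u ∙ α) p) ≋-refl))
      where
      L  = P ⊕ α ++ S ⊕ β
      L′ = u ∙ α ∷ L

    mixtures : ℕ → List A
    mixtures zero    = ε ∷ []
    mixtures (suc k) = suc k · β ∷ mixtures k ⊕ α

    pivotSums mixedSums : ℕ → List A → List A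
    pivotSums k ds = concatMap (pivotTerm k) (pivots ds)
    mixedSums k ds = concatMap (λ c → sums (suc k) ds ⊕ c) (mixtures k)

    pivotSums-suc : ∀ k u us → pivotSums (suc k) (u ∷ us) ↭
      pivotSums k (u ∷ us) ⊕ (u ∙ α) ++ (sums (suc k) ((u ∷ us) ⊕ β) ⊕ u ++ pivotSums (suc k) us)
    pivotSums-suc k u us = begin
      concatMap (pivotTerm (suc k)) (map (consPrefix u) ts)
        ≡⟨ concatMap-map (pivotTerm (suc k)) (consPrefix u) ts ⟩
      concatMap (pivotTerm (suc k) ∘ consPrefix u) ts
        ↭⟨ concatMap-cong↭ (pivotTerm-consPrefix k u) ts ⟩
      concatMap (λ t → pivotTerm k (consPrefix u t) ⊕ (u ∙ α) ++ pivotTerm (suc k) t) ts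
        ↭⟨ concatMap-++-distrib (λ t → pivotTerm k (consPrefix u t) ⊕ (u ∙ α)) (pivotTerm (suc k)) ts ⟩
      concatMap (λ t → pivotTerm k (consPrefix u t) ⊕ (u ∙ α)) ts ++ concatMap (pivotTerm (suc k)) ts
        ≡⟨ ≡.cong (_++ concatMap (pivotTerm (suc k)) ts) (≡.trans
             (concatMap-⊕ (pivotTerm k) (map (consPrefix u) ts) (u ∙ α))
             (concatMap-map (λ t → pivotTerm k t ⊕ (u ∙ α)) (consPrefix u) ts)) ⟨
      pivotSums k (u ∷ us) ⊕ (u ∙ α) ++ concatMap (pivotTerm (suc k)) ts ∎
      where
      open PermutationReasoning
      ts = ([] , u , u ∷ us) ∷ pivots us

    mixedSums-suc : ∀ k u us → mixedSums (suc k) (u ∷ us) ↭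
      mixedSums k (u ∷ us) ⊕ (u ∙ α) ++ (sums (suc k) ((u ∷ us) ⊕ β) ⊕ u ++ mixedSums (suc k) us)
    mixedSums-suc k u us = begin
      concatMap (λ c → (V ⊕ u ++ W) ⊕ c) (mixtures (suc k))
        ≡⟨ concatMap-cong (λ c → map-++ (_∙ c) (V ⊕ u) W) (mixtures (suc k)) ⟩
      concatMap (λ c → V ⊕ u ⊕ c ++ W ⊕ c) (mixtures (suc k))
        ↭⟨ concatMap-++-distrib (λ c → V ⊕ u ⊕ c) (λ c → W ⊕ c) (mixtures (suc k)) ⟩
      (V ⊕ u ⊕ (suc k · β) ++ αs) ++ mixedSums (suc k) us
        ≡⟨ ++-assoc (V ⊕ u ⊕ (suc k · β)) αs (mixedSums (suc k) us) ⟩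
      V ⊕ u ⊕ (suc k · β) ++ αs ++ mixedSums (suc k) us
        ↭⟨ shifts (V ⊕ u ⊕ (suc k · β)) αs ⟩
      αs ++ V ⊕ u ⊕ (suc k · β) ++ mixedSums (suc k) us
        ↭⟨ ++⁺ α-terms (++⁺ʳ (mixedSums (suc k) us) β-term) ⟩
      mixedSums k (u ∷ us) ⊕ (u ∙ α) ++ sums (suc k) ((u ∷ us) ⊕ β) ⊕ u ++ mixedSums (suc k) us ∎
      where
      open PermutationReasoning
      V = sums (suc k) (u ∷ us)
      W = sums (suc (suc k)) us
      αs = concatMap (λ c → V ⊕ u ⊕ c) (mixtures k ⊕ α)
      β-term : V ⊕ u ⊕ (suc k · β) ↭ sums (suc k) ((u ∷ us) ⊕ β) ⊕ u
      β-term = ↭-trans (↭-reflexive-≋ (⊕-comm V u (suc k · β)))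
                       (⊕⁺ u (↭-sym (sums-⊕ (suc k) (u ∷ us) β)))
      α-terms : αs ↭ mixedSums k (u ∷ us) ⊕ (u ∙ α)
      α-terms = begin
        concatMap (λ c → V ⊕ u ⊕ c) (mixtures k ⊕ α)
          ≡⟨ concatMap-map (λ c → V ⊕ u ⊕ c) (_∙ α) (mixtures k) ⟩
        concatMap (λ c → V ⊕ u ⊕ (c ∙ α)) (mixtures k)
          ↭⟨ concatMap-cong↭ (λ c → ↭-reflexive-≋ (⊕-⊕-cong V (x∙yz≈y∙xz u c α))) (mixtures k) ⟩
        concatMap (λ c → V ⊕ c ⊕ (u ∙ α)) (mixtures k)
          ≡⟨ concatMap-⊕ (V ⊕_) (mixtures k) (u ∙ α) ⟨
        mixedSums k (u ∷ us) ⊕ (u ∙ α) ∎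

    pivotSums↭mixedSums : ∀ k ds → pivotSums k ds ↭ mixedSums k ds
    pivotSums↭mixedSums zero    []       = ↭-refl
    pivotSums↭mixedSums zero    (u ∷ us) = prep (sym (identityʳ (ε ∙ u))) (↭-trans
      (↭-reflexive (concatMap-map (pivotTerm zero) (consPrefix u) (pivots us)))
      (pivotSums↭mixedSums zero us))
    pivotSums↭mixedSums (suc k) []       =
      ↭-reflexive (≡.sym (concatMap-const-[] (mixtures (suc k))))
    pivotSums↭mixedSums (suc k) (u ∷ us) = begin
      pivotSums (suc k) (u ∷ us)
        ↭⟨ pivotSums-suc k u us ⟩
      pivotSums k (u ∷ us) ⊕ (u ∙ α) ++ (sums (suc k) ((u ∷ us) ⊕ β) ⊕ u ++ pivotSums (suc k) us)
        ↭⟨ ++⁺ (⊕⁺ _ (pivotSums↭mixedSums k (u ∷ us))) (++⁺ˡ _ (pivotSums↭mixedSums (suc k) us)) ⟩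
      mixedSums k (u ∷ us) ⊕ (u ∙ α) ++ (sums (suc k) ((u ∷ us) ⊕ β) ⊕ u ++ mixedSums (suc k) us)
        ↭⟨ mixedSums-suc k u us ⟨
      mixedSums (suc k) (u ∷ us) ∎
      where open PermutationReasoning

    expansion : ℕ → A → (ℕ → A → List A) → List A
    expansion r γ Φ = ⋃[ k ≤ r ] concatMap (λ c → Φ (suc k) (γ ∙ c)) (mixtures k)

    fR-pivotSums : ∀ r γ x₁ rest → let d = (x₁ ∷ rest) ⊕ x₁ ⁻¹ in
      fM G r γ (R G α β (x₁ ∷ rest)) ↭ (⋃[ k ≤ r ] pivotSums k d) ⊕ (x₁ ∙ γ)
    fR-pivotSums r γ x₁ rest = begin
      fM G r γ (R G α β (x₁ ∷ rest))
        ≡⟨ ≡.cong (fM G r γ) (R-pivots x₁ rest) ⟩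
      fM G r γ (map (Rpivot x₁) (pivots xs))
        ≡⟨ concatMap-map (f G r γ) (Rpivot x₁) (pivots xs) ⟩
      concatMap (f G r γ ∘ Rpivot x₁) (pivots xs)
        ↭⟨ concatMap-cong↭ (f-Rpivot r γ x₁) (pivots xs) ⟩
      concatMap (λ t → (⋃[ k ≤ r ] pivotTerm k (t ⊕ᵖ x₁ ⁻¹)) ⊕ (x₁ ∙ γ)) (pivots xs)
        ≡⟨ concatMap-⊕ (λ t → ⋃[ k ≤ r ] pivotTerm k (t ⊕ᵖ x₁ ⁻¹)) (pivots xs) (x₁ ∙ γ) ⟨
      concatMap (λ t → ⋃[ k ≤ r ] pivotTerm k (t ⊕ᵖ x₁ ⁻¹)) (pivots xs) ⊕ (x₁ ∙ γ)
        ≡⟨ ≡.cong (_⊕ (x₁ ∙ γ)) (≡.trans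
             (≡.cong (concatMap (λ t → ⋃[ k ≤ r ] pivotTerm k t)) (pivots-⊕ xs (x₁ ⁻¹)))
             (concatMap-map (λ t → ⋃[ k ≤ r ] pivotTerm k t) (_⊕ᵖ x₁ ⁻¹) (pivots xs))) ⟨
      concatMap (λ t → ⋃[ k ≤ r ] pivotTerm k t) (pivots (xs ⊕ x₁ ⁻¹)) ⊕ (x₁ ∙ γ)
        ↭⟨ ⊕⁺ _ (concatMap-comm (λ t k → pivotTerm k t) (pivots (xs ⊕ x₁ ⁻¹)) (downFrom (suc r))) ⟩
      (⋃[ k ≤ r ] pivotSums k (xs ⊕ x₁ ⁻¹)) ⊕ (x₁ ∙ γ) ∎
      where
      open PermutationReasoning
      xs : List A
      xs = x₁ ∷ rest

    fR-expansion : ∀ r γ x → fM G r γ (R G α β x) ↭ expansion r γ (λ n δ → f G n δ x)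
    fR-expansion r γ (x₁ ∷ rest) = begin
      fM G r γ (R G α β (x₁ ∷ rest))
        ↭⟨ fR-pivotSums r γ x₁ rest ⟩
      (⋃[ k ≤ r ] pivotSums k d) ⊕ (x₁ ∙ γ)
        ↭⟨ ⊕⁺ _ (concatMap-cong↭ (λ k → pivotSums↭mixedSums k d) (downFrom (suc r))) ⟩
      (⋃[ k ≤ r ] mixedSums k d) ⊕ (x₁ ∙ γ)
        ≡⟨ ≡.trans (concatMap-⊕ (λ k → mixedSums k d) (downFrom (suc r)) (x₁ ∙ γ))
             (concatMap-cong (λ k → concatMap-⊕ (λ c → sums (suc k) d ⊕ c) (mixtures k) (x₁ ∙ γ))
                             (downFrom (suc r))) ⟩
      ⋃[ k ≤ r ] concatMap (λ c → sums (suc k) d ⊕ c ⊕ (x₁ ∙ γ)) (mixtures k)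
        ↭⟨ concatMap-cong↭ (λ k → concatMap-cong↭ (term k) (mixtures k)) (downFrom (suc r)) ⟩
      expansion r γ (λ n δ → f G n δ (x₁ ∷ rest)) ∎
      where
      open PermutationReasoning
      d = (x₁ ∷ rest) ⊕ x₁ ⁻¹
      term : ∀ k c → sums (suc k) d ⊕ c ⊕ (x₁ ∙ γ) ↭ f G (suc k) (γ ∙ c) (x₁ ∷ rest)
      term k c = ↭-trans
        (↭-reflexive-≋ (≋-trans (⊕-⊕ (sums (suc k) d) c (x₁ ∙ γ)) (⊕-congʳ _ (x∙yz≈y∙zx c x₁ γ))))
        (↭-sym (f-normal-form (suc k) (γ ∙ c) x₁ rest))

    expansion-cong : ∀ r γ {Φ Ψ} → (∀ n δ → Φ n δ ↭ Ψ n δ) → expansion r γ Φ ↭ expansion r γ Ψ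
    expansion-cong r γ Φ↭Ψ = concatMap-cong↭
      (λ k → concatMap-cong↭ (λ c → Φ↭Ψ (suc k) (γ ∙ c)) (mixtures k)) (downFrom (suc r))

    expansion-concatMap : ∀ {b} {B : Set b} r γ (Φ : B → ℕ → A → List A) xs →
      concatMap (λ x → expansion r γ (Φ x)) xs ↭ expansion r γ (λ n δ → concatMap (λ x → Φ x n δ) xs)
    expansion-concatMap r γ Φ xs = ↭-trans
      (concatMap-comm (λ x k → concatMap (λ c → Φ x (suc k) (γ ∙ c)) (mixtures k))
                      xs (downFrom (suc r)))
      (concatMap-cong↭ (λ k → concatMap-comm (λ x c → Φ x (suc k) (γ ∙ c)) xs (mixtures k))
                       (downFrom (suc r)))

    fRM-expansion : ∀ r γ X → fM G r γ (RM G α β X) ↭ expansion r γ (λ n δ → fM G n δ X)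
    fRM-expansion r γ X = begin
      fM G r γ (RM G α β X)
        ≡⟨ MonadProperties.associative X (R G α β) (f G r γ) ⟨
      concatMap (λ x → fM G r γ (R G α β x)) X
        ↭⟨ concatMap-cong↭ (fR-expansion r γ) X ⟩
      concatMap (λ x → expansion r γ (λ n δ → f G n δ x)) X
        ↭⟨ expansion-concatMap r γ (λ x n δ → f G n δ x) X ⟩
      expansion r γ (λ n δ → fM G n δ X) ∎
      where open PermutationReasoning

  mixtures-suc′ : ∀ α β k → mixtures α β (suc k) ↭ suc k · α ∷ mixtures α β k ⊕ β
  mixtures-suc′ α β zero    = swap (comm β ε) (comm ε α) ↭-refl
  mixtures-suc′ α β (suc k) = ↭-trans (prep refl (⊕⁺ α (mixtures-suc′ α β k)))
    (swap (comm β (suc k · β)) (comm (suc k · α) α) (↭-reflexive-≋ (⊕-comm (mixtures α β k) β α)))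

  mixtures-comm : ∀ α β k → mixtures α β k ↭ mixtures β α k
  mixtures-comm α β zero    = ↭-refl
  mixtures-comm α β (suc k) = ↭-trans (mixtures-suc′ α β k) (prep refl (⊕⁺ β (mixtures-comm α β k)))

  expansion-comm : ∀ α β r γ {Φ} → (∀ n {δ δ′} → δ ≈ δ′ → Φ n δ ↭ Φ n δ′) →
    expansion α β r γ Φ ↭ expansion β α r γ Φ
  expansion-comm α β r γ Φ-cong = concatMap-cong↭
    (λ k → concatMap⁺ (λ c≈c′ → Φ-cong (suc k) (∙-congˡ c≈c′)) (mixtures-comm α β k))
    (downFrom (suc r))

lemma2p4 : ∀ {c ℓ : Level} (G : AbelianGroup c ℓ) →
    let open AbelianGroup G renaming (Carrier to A) in
    (X Y : List (Seq G)) →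
    (∀ (r : ℕ) (γ : A) → _≋ₘ_ G (fM G r γ X) (fM G r γ Y)) →
    ∀ (α β : A) →
      (∀ (r : ℕ) (γ : A) → _≋ₘ_ G (fM G r γ (RM G α β X)) (fM G r γ (RM G α β Y)))
      × (∀ (r : ℕ) (γ : A) → _≋ₘ_ G (fM G r γ (RM G α β X)) (fM G r γ (RM G β α Y)))
lemma2p4 G X Y fX↭fY α β = same , swapped
  where
  open AbelianGroup G using (setoid)
  open Properties G
  open Permutation setoid using (_↭_; module PermutationReasoning)
  open PermutationReasoning

  same : ∀ r γ → fM G r γ (RM G α β X) ↭ fM G r γ (RM G α β Y)
  same r γ = begin
    fM G r γ (RM G α β X)                   ↭⟨ fRM-expansion α β r γ X ⟩
    expansion α β r γ (λ n δ → fM G n δ X)  ↭⟨ expansion-cong α β r γ fX↭fY ⟩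
    expansion α β r γ (λ n δ → fM G n δ Y)  ↭⟨ fRM-expansion α β r γ Y ⟨
    fM G r γ (RM G α β Y)                   ∎

  swapped : ∀ r γ → fM G r γ (RM G α β X) ↭ fM G r γ (RM G β α Y)
  swapped r γ = begin
    fM G r γ (RM G α β X)                   ↭⟨ fRM-expansion α β r γ X ⟩
    expansion α β r γ (λ n δ → fM G n δ X)  ↭⟨ expansion-cong α β r γ fX↭fY ⟩
    expansion α β r γ (λ n δ → fM G n δ Y)  ↭⟨ expansion-comm α β r γ (λ n δ≈δ′ → fM-cong n δ≈δ′ Y) ⟩
    expansion β α r γ (λ n δ → fM G n δ Y)  ↭⟨ fRM-expansion β α r γ Y ⟨
    fM G r γ (RM G β α Y)                   ∎
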